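{- Let $\tau$ be a set of positions that is DN for a logic program $P$. Then the filter $\Delta[\tau]$ associated to $\tau$ is DN for $P$.
   Context: Fix a first-order language $\mathcal L$ with infinitely many constant symbols; $\Pi$ is its set of relation symbols, each $p$ with unique arity $arity(p)$; $TU_{\mathcal L}$ is the set of all terms; $[1,n]=\{1,\dots,n\}$. A query is a finite sequence of atoms; a logic program is a finite set of definite clauses. SLD-derivation step: given a query $\mathbf A,B,\mathbf C$ and a clause $c$, take a variant $H\leftarrow\mathbf B$ of $c$ variable disjoint from the query with $B,H$ unifiable and mgu $\theta$; then $\mathbf A,B,\mathbf C\Rightarrow_c^\theta(\mathbf A,\mathbf B,\mathbf C)\theta$ (selected atom $B$). A term-condition is a map $TU_{\mathcal L}\to\{\mathtt{true},\mathtt{false}\}$. A filter $\Delta$ assigns to each $p\in\Pi$ a partial function $\Delta(p)$ from $[1,arity(p)]$ to term-conditions. For a substitution $\eta$, an atom $A=p(s_1,\dots,s_n)$ is $\Delta$-more general than $B$ for $\eta$ if $B=p(t_1,\dots,t_n)$, $t_i=s_i\eta$ for $i\notin Dom(\Delta(p))$, and $\Delta(p)(i)(s_i)=\mathtt{true}$ for $i\in Dom(\Delta(p))$; a query $A_1,\dots,A_n$ is $\Delta$-more general than $B_1,\dots,B_m$ for $\eta$ if $n=m$ and componentwise for the same $\eta$; "$\Delta$-more general" means for some $\eta$. For one-step sequences $Q\Rightarrow_cQ_1$ and $Q'\Rightarrow_cQ'_1$, the latter is a $\Delta$-lift of the former if $Q'$ is $\Delta$-more general than $Q$, $Q'_1$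 is $\Delta$-more general than $Q_1$, and atoms in the same positions are selected in $Q$ and $Q'$. $\Delta$ is DN for a clause $c$ if for every step $Q\Rightarrow_cQ_1$ and every query $Q'$ $\Delta$-more general than $Q$ there is $Q'_1$ with $Q'\Rightarrow_cQ'_1$ a $\Delta$-lift of $Q\Rightarrow_cQ_1$; DN for $P$ if DN for each clause of $P$. A set of positions $\tau$ maps each $p\in\Pi$ to a subset $\tau(p)\subseteq[1,arity(p)]$. Its associated filter $\Delta[\tau]$ maps each $p$ to the function with domain $\tau(p)$ sending every $i\in\tau(p)$ to the constant term-condition $f_{\mathit{true}}$ ($t\mapsto\mathtt{true}$ for all $t$). $\tau$ is DN for a clause $p(s_1,\dots,s_n)\leftarrow\mathbf B$ if for every $i\in\tau(p)$: $s_i$ is a variable, $s_i$ occurs only once in $p(s_1,\dots,s_n)$, and for each atom $q(t_1,\dots,t_m)$ in $\mathbf B$ and each $j\in[1,m]$, $s_i\in Var(t_j)$ implies $j\in\tau(q)$. $\tau$ is DN for a program if it is DN for each of its clauses. -}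

module Defs where

open import Data.Nat using (ℕ)
open import Data.Bool using (Bool; true; false; if_then_else_)
open import Data.Fin using (Fin)
open import Data.Maybe using (Maybe; just; nothing)
open import Data.Vec using (Vec; []; _∷_; lookup)
open import Data.List using (List; []; _∷_; _++_; length)
open import Data.List.Membership.Propositional using (_∈_; _∉_)
open import Data.List.Relation.Binary.Pointwise using (Pointwise)
open import Data.Product using (Σ; ∃; _×_; _,_)
open import Data.Empty using (⊥)
open import Function using (_∘_; Injective)
open import Relation.Binary.PropositionalEquality using (_≡_; _≢_)

record Signature : Set₁ where
  field
    Fun      : Set
    ar       : Fun → ℕ
    Π        : Set
    arity    : Π → ℕ
    const    : ℕ → Fun
    const-ar : ∀ n → ar (const n) ≡ 0
    const-inj : Injective _≡_ _≡_ const

module Lang (L : Signature) where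
  open Signature L

  data Term : Set where
    var : ℕ → Term
    fn  : (f : Fun) → Vec Term (ar f) → Term

  Subst : Set
  Subst = ℕ → Term

  mutual
    sub : Subst → Term → Term
    sub σ (var x)   = σ x
    sub σ (fn f ts) = fn f (subs σ ts)

    subs : ∀ {n} → Subst → Vec Term n → Vec Term n
    subs σ []       = []
    subs σ (t ∷ ts) = sub σ t ∷ subs σ ts

  mutual
    vars : Term → List ℕ
    vars (var x)   = x ∷ []
    vars (fn f ts) = varsV ts

    varsV : ∀ {n} → Vec Term n → List ℕ
    varsV []       = []
    varsV (t ∷ ts) = vars t ++ varsV ts

  Finite : Subst → Set
  Finite σ = ∃ λ (xs : List ℕ) → ∀ x → x ∉ xs → σ x ≡ var x

  data Atom : Set where
    atom : (p : Π) → Vec Term (arity p) → Atom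

  subA : Subst → Atom → Atom
  subA σ (atom p ts) = atom p (subs σ ts)

  varsA : Atom → List ℕ
  varsA (atom p ts) = varsV ts

  Query : Set
  Query = List Atom

  subQ : Subst → Query → Query
  subQ σ []       = []
  subQ σ (A ∷ Q)  = subA σ A ∷ subQ σ Q

  varsQ : Query → List ℕ
  varsQ []      = []
  varsQ (A ∷ Q) = varsA A ++ varsQ Q

  data Clause : Set where
    _⇐_ : Atom → List Atom → Clause

  subC : Subst → Clause → Clause
  subC σ (H ⇐ B) = subA σ H ⇐ subQ σ B

  varsC : Clause → List ℕ
  varsC (H ⇐ B) = varsA H ++ varsQ B

  Program : Set
  Program = List Clause

  record Renaming : Set where
    field
      π       : ℕ → ℕ
      π⁻¹     : ℕ → ℕ
      inv₁    : ∀ x → π⁻¹ (π x) ≡ x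
      inv₂    : ∀ x → π (π⁻¹ x) ≡ x
      support : List ℕ
      fixed   : ∀ x → x ∉ support → π x ≡ x

  Variant : Clause → Clause → Set
  Variant c' c = Σ Renaming λ ρ → c' ≡ subC (var ∘ Renaming.π ρ) c

  Unifier : Subst → Atom → Atom → Set
  Unifier θ A B = subA θ A ≡ subA θ B

  MGU : Subst → Atom → Atom → Set
  MGU θ A B = Finite θ × Unifier θ A B ×
    (∀ σ → Finite σ → Unifier σ A B →
       ∃ λ δ → Finite δ × (∀ x → σ x ≡ sub δ (θ x)))

  -- One SLD-derivation step  Q ⇒_c Q₁  selecting the atom at position k
  -- (0-based index into the query).
  Step : Clause → Query → ℕ → Query → Set
  Step c Q k Q₁ =
    ∃ λ (As : Query) → ∃ λ (B : Atom) → ∃ λ (Cs : Query) →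
    ∃ λ (H : Atom) → ∃ λ (Bs : Query) → ∃ λ (θ : Subst) →
      Q ≡ As ++ (B ∷ Cs) × length As ≡ k ×
      Variant (H ⇐ Bs) c ×
      (∀ x → x ∈ varsC (H ⇐ Bs) → x ∈ varsQ Q → ⊥) ×
      MGU θ B H ×
      Q₁ ≡ subQ θ (As ++ Bs ++ Cs)

  TermCondition : Set
  TermCondition = Term → Bool

  Filter : Set
  Filter = (p : Π) → Fin (arity p) → Maybe TermCondition

  ArgCond : Subst → Maybe TermCondition → Term → Term → Set
  ArgCond η nothing  s t = t ≡ sub η s
  ArgCond η (just f) s t = f s ≡ true

  data MoreGenAtom (Δ : Filter) (η : Subst) : Atom → Atom → Set where
    mg : ∀ {p ss ts} →
         (∀ i → ArgCond η (Δ p i) (lookup ss i) (lookup ts i)) →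
         MoreGenAtom Δ η (atom p ss) (atom p ts)

  MoreGenQueryFor : Filter → Subst → Query → Query → Set
  MoreGenQueryFor Δ η = Pointwise (MoreGenAtom Δ η)

  MoreGenQuery : Filter → Query → Query → Set
  MoreGenQuery Δ Q Q' = ∃ λ η → Finite η × MoreGenQueryFor Δ η Q Q'

  DeltaLift : Filter → Clause → Query → Query → ℕ → Query → Query → Set
  DeltaLift Δ c Q Q₁ k Q' Q'₁ =
    Step c Q' k Q'₁ × MoreGenQuery Δ Q' Q × MoreGenQuery Δ Q'₁ Q₁

  DNClause : Filter → Clause → Set
  DNClause Δ c = ∀ Q k Q₁ → Step c Q k Q₁ → ∀ Q' → MoreGenQuery Δ Q' Q →
    ∃ λ Q'₁ → DeltaLift Δ c Q Q₁ k Q' Q'₁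

  DNProgram : Filter → Program → Set
  DNProgram Δ P = ∀ c → c ∈ P → DNClause Δ c

  Positions : Set
  Positions = (p : Π) → Fin (arity p) → Bool

  ftrue : TermCondition
  ftrue _ = true

  filterOf : Positions → Filter
  filterOf τ p i = if τ p i then just ftrue else nothing

  DNPosClause : Positions → Clause → Set
  DNPosClause τ (atom p ss ⇐ Bs) =
    ∀ i → τ p i ≡ true →
      ∃ λ x → lookup ss i ≡ var x ×
        (∀ j → j ≢ i → x ∉ vars (lookup ss j)) ×
        (∀ q ts → atom q ts ∈ Bs → ∀ j → x ∈ vars (lookup ts j) → τ q j ≡ true)

  DNPosProgram : Positions → Program → Set
  DNPosProgram τ P = ∀ c → c ∈ P → DNPosClause τ c

-- Let Q ⇒ Q₁ resolve the selected atom of Q with the variant c ρ of c = p(s⃗) ← B⃗ via the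
-- unifier θ, and let Q' be Δ[τ]-more general than Q via η.  Rename c apart from Q' by a fresh
-- permutation π and let σ be θ ∘ η on the variables of Q' and θ ∘ ρ ∘ π⁻¹ on the renamed
-- clause, except that a head variable sitting at a position of τ is sent to the θ ∘ η-image of
-- the corresponding argument of the selected atom of Q'.  As these head variables are distinct
-- and occur once, σ unifies that atom with the new head: at positions of τ by construction,
-- elsewhere because Q' and Q agree there up to η.  So an mgu θ' exists and σ = δ ∘ θ'.  The
-- variables of the body at positions outside τ are not such head variables, so σ agrees there
-- with θ ∘ ρ ∘ π⁻¹, and δ witnesses that the resolvent of Q' is Δ[τ]-more general than Q₁.

module Submission where

open import Defs
open import Data.Nat as ℕ using (ℕ; suc; _<_; _≤_; _+_; _∸_; s≤s)
open import Data.Nat.Properties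
open import Data.Bool using (true; false)
open import Data.Bool.Properties using () renaming (_≟_ to _≟ᵇ_)
open import Data.Fin using (zero; suc)
import Data.Fin.Properties as Fin
open import Data.Vec using (Vec; []; _∷_; lookup)
open import Data.Vec.Properties using (tabulate∘lookup; tabulate-cong; ∷-injective)
open import Data.List using (List; []; _∷_; _++_; upTo)
open import Data.List.Extrema.Nat using (max; xs≤max)
import Data.List.Relation.Unary.All as All
open import Data.List.Relation.Unary.Any using (here; there)
open import Data.List.Membership.Propositional using (_∈_; _∉_)
open import Data.List.Membership.Propositional.Properties using (∈-++⁺ˡ; ∈-++⁺ʳ; ∈-++⁻; ∈-upTo⁺)
open import Data.List.Membership.DecPropositional ℕ._≟_ using (_∈?_)
open import Data.List.Relation.Binary.Subset.Propositional using (_⊆_)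
open import Data.List.Relation.Binary.Pointwise using (Pointwise; []; _∷_; ++⁺; Pointwise-length)
open import Data.Product using (∃; ∃-syntax; _×_; _,_; proj₁; proj₂; map₂)
open import Data.Sum using (inj₁; inj₂)
open import Data.Empty using (⊥-elim)
open import Function using (_∘_; id)
open import Relation.Nullary using (Dec; yes; no; ¬_)
open import Relation.Nullary.Decidable using (_×-dec_)
open import Relation.Binary.PropositionalEquality

Pointwise-++-∷⁻ : ∀ {A B : Set} {R : A → B → Set} xs {y ys zs} → Pointwise R zs (xs ++ y ∷ ys) →
                  ∃[ xs' ] ∃[ y' ] ∃[ ys' ] zs ≡ xs' ++ y' ∷ ys' ×
                    Pointwise R xs' xs × R y' y × Pointwise R ys' ys
Pointwise-++-∷⁻ []       (r ∷ rs) = [] , _ , _ , refl , [] , r , rs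
Pointwise-++-∷⁻ (x ∷ xs) (r ∷ rs) with Pointwise-++-∷⁻ xs rs
... | xs' , y' , ys' , refl , rxs , ry , rys = _ ∷ xs' , y' , ys' , refl , r ∷ rxs , ry , rys

∈-++-map : ∀ {A B : Set} {P : A → B → Set} xs' {ys' xs ys x} →
           (x ∈ xs' → ∃[ y ] y ∈ xs × P x y) → (x ∈ ys' → ∃[ y ] y ∈ ys × P x y) →
           x ∈ xs' ++ ys' → ∃[ y ] y ∈ xs ++ ys × P x y
∈-++-map xs' f g m with ∈-++⁻ xs' m
... | inj₁ m₁ = let y , y∈ , p = f m₁ in y , ∈-++⁺ˡ y∈ , p
... | inj₂ m₂ = let y , y∈ , p = g m₂ in y , ∈-++⁺ʳ _ y∈ , p

true≢false : true ≢ false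
true≢false ()

lookup-ext : ∀ {A : Set} {n} (xs ys : Vec A n) → (∀ i → lookup xs i ≡ lookup ys i) → xs ≡ ys
lookup-ext xs ys h = trans (sym (tabulate∘lookup xs)) (trans (tabulate-cong h) (tabulate∘lookup ys))

blockSwap : ℕ → ℕ → ℕ
blockSwap N x with x ℕ.<? N | x ℕ.<? N + N
... | yes _ | _     = x + N
... | no _  | yes _ = x ∸ N
... | no _  | no _  = x

blockSwap-< : ∀ N {x} → x < N → blockSwap N x ≡ x + N
blockSwap-< N {x} x<N with x ℕ.<? N
... | yes _   = refl
... | no x≮N = ⊥-elim (x≮N x<N)

blockSwap-mid : ∀ N {x} → N ≤ x → x < N + N → blockSwap N x ≡ x ∸ N
blockSwap-mid N {x} N≤x x<2N with x ℕ.<? N | x ℕ.<? N + N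
... | yes x<N | _       = ⊥-elim (<⇒≱ x<N N≤x)
... | no _    | yes _   = refl
... | no _    | no x≮2N = ⊥-elim (x≮2N x<2N)

blockSwap-≥ : ∀ N {x} → ¬ x < N + N → blockSwap N x ≡ x
blockSwap-≥ N {x} x≮2N with x ℕ.<? N | x ℕ.<? N + N
... | yes x<N | _       = ⊥-elim (x≮2N (<-≤-trans x<N (m≤m+n N N)))
... | no _    | yes x<2N = ⊥-elim (x≮2N x<2N)
... | no _    | no _    = refl

blockSwap-involutive : ∀ N x → blockSwap N (blockSwap N x) ≡ x
blockSwap-involutive N x with x ℕ.<? N | x ℕ.<? N + N
... | yes x<N | _ = trans (blockSwap-mid N (m≤n+m N x) (+-monoˡ-< N x<N)) (m+n∸n≡m x N)
... | no x≮N | yes x<2N =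
  trans (blockSwap-< N (subst (x ∸ N <_) (m+n∸n≡m N N) (∸-monoˡ-< x<2N (≮⇒≥ x≮N)))) (m∸n+n≡m (≮⇒≥ x≮N))
... | no _ | no x≮2N = blockSwap-≥ N x≮2N

module _ (L : Signature) where
  open Signature L
  open Lang L

  mutual
    sub-∘ : ∀ δ θ t → sub δ (sub θ t) ≡ sub (sub δ ∘ θ) t
    sub-∘ δ θ (var x)   = refl
    sub-∘ δ θ (fn f ts) = cong (fn f) (subs-∘ δ θ ts)

    subs-∘ : ∀ {n} δ θ (ts : Vec Term n) → subs δ (subs θ ts) ≡ subs (sub δ ∘ θ) ts
    subs-∘ δ θ []       = refl
    subs-∘ δ θ (t ∷ ts) = cong₂ _∷_ (sub-∘ δ θ t) (subs-∘ δ θ ts)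

  mutual
    sub-cong : ∀ {σ σ'} t → (∀ {x} → x ∈ vars t → σ x ≡ σ' x) → sub σ t ≡ sub σ' t
    sub-cong (var x)   h = h (here refl)
    sub-cong (fn f ts) h = cong (fn f) (subs-cong ts h)

    subs-cong : ∀ {n σ σ'} (ts : Vec Term n) → (∀ {x} → x ∈ varsV ts → σ x ≡ σ' x) → subs σ ts ≡ subs σ' ts
    subs-cong []       h = refl
    subs-cong (t ∷ ts) h = cong₂ _∷_ (sub-cong t (h ∘ ∈-++⁺ˡ)) (subs-cong ts (h ∘ ∈-++⁺ʳ (vars t)))

  mutual
    sub-var : ∀ t → sub var t ≡ t
    sub-var (var x)   = refl
    sub-var (fn f ts) = cong (fn f) (subs-var ts)

    subs-var : ∀ {n} (ts : Vec Term n) → subs var ts ≡ ts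
    subs-var []       = refl
    subs-var (t ∷ ts) = cong₂ _∷_ (sub-var t) (subs-var ts)

  sub-factor : ∀ {σ δ θ} → σ ≗ sub δ ∘ θ → ∀ t → sub σ t ≡ sub δ (sub θ t)
  sub-factor σ≗δθ t = trans (sub-cong t λ _ → σ≗δθ _) (sym (sub-∘ _ _ t))

  subs-factor : ∀ {n σ δ θ} → σ ≗ sub δ ∘ θ → (ts : Vec Term n) → subs σ ts ≡ subs δ (subs θ ts)
  subs-factor σ≗δθ ts = trans (subs-cong ts λ _ → σ≗δθ _) (sym (subs-∘ _ _ ts))

  lookup-subs : ∀ {n} σ (ts : Vec Term n) i → lookup (subs σ ts) i ≡ sub σ (lookup ts i)
  lookup-subs σ (t ∷ ts) zero    = refl
  lookup-subs σ (t ∷ ts) (suc i) = lookup-subs σ ts i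

  vars-lookup : ∀ {n} (ts : Vec Term n) i → vars (lookup ts i) ⊆ varsV ts
  vars-lookup (t ∷ ts) zero    = ∈-++⁺ˡ
  vars-lookup (t ∷ ts) (suc i) = ∈-++⁺ʳ (vars t) ∘ vars-lookup ts i

  mutual
    vars-sub⁻ : ∀ σ t {x} → x ∈ vars (sub σ t) → ∃[ y ] y ∈ vars t × x ∈ vars (σ y)
    vars-sub⁻ σ (var y)   m = y , here refl , m
    vars-sub⁻ σ (fn f ts) m = varsV-sub⁻ σ ts m

    varsV-sub⁻ : ∀ {n} σ (ts : Vec Term n) {x} → x ∈ varsV (subs σ ts) → ∃[ y ] y ∈ varsV ts × x ∈ vars (σ y)
    varsV-sub⁻ σ (t ∷ ts) = ∈-++-map {P = λ x y → x ∈ vars (σ y)} (vars (sub σ t)) (vars-sub⁻ σ t) (varsV-sub⁻ σ ts)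

  varsQ-sub⁻ : ∀ σ Xs {x} → x ∈ varsQ (subQ σ Xs) → ∃[ y ] y ∈ varsQ Xs × x ∈ vars (σ y)
  varsQ-sub⁻ σ (atom q ts ∷ Xs) = ∈-++-map {P = λ x y → x ∈ vars (σ y)} (varsV (subs σ ts)) (varsV-sub⁻ σ ts) (varsQ-sub⁻ σ Xs)

  varsC-sub⁻ : ∀ σ c {x} → x ∈ varsC (subC σ c) → ∃[ y ] y ∈ varsC c × x ∈ vars (σ y)
  varsC-sub⁻ σ (atom q ts ⇐ Xs) = ∈-++-map {P = λ x y → x ∈ vars (σ y)} (varsV (subs σ ts)) (varsV-sub⁻ σ ts) (varsQ-sub⁻ σ Xs)

  ∈-varsQ : ∀ {A Xs} → A ∈ Xs → varsA A ⊆ varsQ Xs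
  ∈-varsQ {atom q ts} (here refl) = ∈-++⁺ˡ
  ∈-varsQ {Xs = X ∷ Xs} (there A∈) = ∈-++⁺ʳ (varsA X) ∘ ∈-varsQ A∈

  subQ-++ : ∀ σ Xs Ys → subQ σ (Xs ++ Ys) ≡ subQ σ Xs ++ subQ σ Ys
  subQ-++ σ []       Ys = refl
  subQ-++ σ (X ∷ Xs) Ys = cong (subA σ X ∷_) (subQ-++ σ Xs Ys)

  Pointwise-subQ-++⁺ : ∀ {R : Atom → Atom → Set} {σ σ'} Xs Xs' {Ys Ys'} →
                       Pointwise R (subQ σ Xs) (subQ σ' Xs') → Pointwise R (subQ σ Ys) (subQ σ' Ys') →
                       Pointwise R (subQ σ (Xs ++ Ys)) (subQ σ' (Xs' ++ Ys'))
  Pointwise-subQ-++⁺ {R} {σ} {σ'} Xs Xs' {Ys} {Ys'} rXs rYs =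
    subst₂ (Pointwise R) (sym (subQ-++ σ Xs Ys)) (sym (subQ-++ σ' Xs' Ys')) (++⁺ rXs rYs)

  mutual
    size : Term → ℕ
    size (var x)   = 1
    size (fn f ts) = suc (sizeV ts)

    sizeV : ∀ {n} → Vec Term n → ℕ
    sizeV []       = 0
    sizeV (t ∷ ts) = size t + sizeV ts

  mutual
    size-sub-var : ∀ σ t {x} → x ∈ vars t → size (σ x) ≤ size (sub σ t)
    size-sub-var σ (var y)   (here refl) = ≤-refl
    size-sub-var σ (fn f ts) m           = m≤n⇒m≤1+n (sizeV-subs-var σ ts m)

    sizeV-subs-var : ∀ {n} σ (ts : Vec Term n) {x} → x ∈ varsV ts → size (σ x) ≤ sizeV (subs σ ts)
    sizeV-subs-var σ (t ∷ ts) m with ∈-++⁻ (vars t) m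
    ... | inj₁ m₁ = ≤-trans (size-sub-var σ t m₁) (m≤m+n _ _)
    ... | inj₂ m₂ = ≤-trans (sizeV-subs-var σ ts m₂) (m≤n+m _ _)

  occurs-check : ∀ σ {x f ts} → x ∈ varsV ts → σ x ≢ sub σ (fn f ts)
  occurs-check σ {ts = ts} x∈ eq =
    <-irrefl refl (≤-<-trans (sizeV-subs-var σ ts x∈) (≤-reflexive (cong size (sym eq))))

  Unifies : Term → Term → Subst → Set
  Unifies t u σ = sub σ t ≡ sub σ u

  Unifiesᵛ : ∀ {n} → Vec Term n → Vec Term n → Subst → Set
  Unifiesᵛ ts us σ = subs σ ts ≡ subs σ us

  IsMGU : (Subst → Set) → Subst → Set
  IsMGU U θ = Finite θ × U θ × (∀ σ → Finite σ → U σ → ∃ λ δ → Finite δ × σ ≗ sub δ ∘ θ)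

  IsMGU-resp : ∀ {U U' θ} → (∀ {σ} → U σ → U' σ) → (∀ {σ} → U' σ → U σ) → IsMGU U θ → IsMGU U' θ
  IsMGU-resp to from (finθ , uθ , gen) = finθ , to uθ , λ σ finσ uσ → gen σ finσ (from uσ)

  var-IsMGU : ∀ {U} → U var → IsMGU U var
  var-IsMGU u = ([] , λ _ _ → refl) , u , λ σ finσ _ → σ , finσ , λ _ → refl

  Finite-∘ : ∀ {δ θ} → Finite δ → Finite θ → Finite (sub δ ∘ θ)
  Finite-∘ {δ} (xs , δ-fix) (ys , θ-fix) =
    ys ++ xs , λ x x∉ → trans (cong (sub δ) (θ-fix x (x∉ ∘ ∈-++⁺ˡ))) (δ-fix x (x∉ ∘ ∈-++⁺ʳ ys))

  _↦_ : ℕ → Term → Subst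
  (x ↦ u) y with y ℕ.≟ x
  ... | yes _ = u
  ... | no _  = var y

  ↦-here : ∀ x u → (x ↦ u) x ≡ u
  ↦-here x u with x ℕ.≟ x
  ... | yes _  = refl
  ... | no x≢x = ⊥-elim (x≢x refl)

  ↦-there : ∀ {x y} u → y ≢ x → (x ↦ u) y ≡ var y
  ↦-there {x} {y} u y≢x with y ℕ.≟ x
  ... | yes y≡x = ⊥-elim (y≢x y≡x)
  ... | no _    = refl

  ↦-IsMGU : ∀ {x u} → x ∉ vars u → IsMGU (Unifies (var x) u) (x ↦ u)
  ↦-IsMGU {x} {u} x∉u = (x ∷ [] , λ y y∉ → ↦-there u (y∉ ∘ here)) , unifies , general
    where
      unifies : (x ↦ u) x ≡ sub (x ↦ u) u
      unifies = trans (↦-here x u) (sym (trans (sub-cong u λ y∈ → ↦-there u λ { refl → x∉u y∈ }) (sub-var u)))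

      general : ∀ ρ → Finite ρ → ρ x ≡ sub ρ u → ∃ λ δ → Finite δ × ρ ≗ sub δ ∘ (x ↦ u)
      general ρ finρ ρx≡ρu = ρ , finρ , agree
        where
          agree : ρ ≗ sub ρ ∘ (x ↦ u)
          agree y with y ℕ.≟ x
          ... | yes refl = ρx≡ρu
          ... | no _     = refl

  ∷-IsMGU : ∀ {n θ₁ θ₂ t u} {ts us : Vec Term n} → IsMGU (Unifies t u) θ₁ →
            IsMGU (Unifiesᵛ (subs θ₁ ts) (subs θ₁ us)) θ₂ →
            IsMGU (Unifiesᵛ (t ∷ ts) (u ∷ us)) (sub θ₂ ∘ θ₁)
  ∷-IsMGU {θ₁ = θ₁} {θ₂} {t} {u} {ts} {us} (fin₁ , uni₁ , gen₁) (fin₂ , uni₂ , gen₂) =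
    Finite-∘ fin₂ fin₁ , cong₂ _∷_ head tail , general
    where
      head : sub (sub θ₂ ∘ θ₁) t ≡ sub (sub θ₂ ∘ θ₁) u
      head = trans (sym (sub-∘ θ₂ θ₁ t)) (trans (cong (sub θ₂) uni₁) (sub-∘ θ₂ θ₁ u))

      tail : subs (sub θ₂ ∘ θ₁) ts ≡ subs (sub θ₂ ∘ θ₁) us
      tail = trans (sym (subs-∘ θ₂ θ₁ ts)) (trans uni₂ (subs-∘ θ₂ θ₁ us))

      general : ∀ ρ → Finite ρ → Unifiesᵛ (t ∷ ts) (u ∷ us) ρ → ∃ λ δ → Finite δ × ρ ≗ sub δ ∘ (sub θ₂ ∘ θ₁)
      general ρ finρ eq with ∷-injective eq
      ... | eq₁ , eq₂ with gen₁ ρ finρ eq₁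
      ... | δ₁ , finδ₁ , ρ≗δ₁θ₁ with gen₂ δ₁ finδ₁ (trans (sym (subs-factor ρ≗δ₁θ₁ ts)) (trans eq₂ (subs-factor ρ≗δ₁θ₁ us)))
      ... | δ₂ , finδ₂ , δ₁≗δ₂θ₂ = δ₂ , finδ₂ , λ x → trans (ρ≗δ₁θ₁ x) (sub-factor δ₁≗δ₂θ₂ (θ₁ x))

  fn-injective : ∀ {f g ts us} → fn f ts ≡ fn g us → ∃ λ (f≡g : f ≡ g) → subst (Vec Term ∘ ar) f≡g ts ≡ us
  fn-injective refl = refl , refl

  fn-IsMGU : ∀ {θ f} {ts us : Vec Term (ar f)} → IsMGU (Unifiesᵛ ts us) θ → IsMGU (Unifies (fn f ts) (fn f us)) θ
  fn-IsMGU = IsMGU-resp (cong (fn _)) fn-injectiveʳ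
    where
      fn-injectiveʳ : ∀ {f} {ts us : Vec Term (ar f)} → fn f ts ≡ fn f us → ts ≡ us
      fn-injectiveʳ refl = refl

  atom-injective : ∀ {p q ts us} → atom p ts ≡ atom q us → ∃ λ (p≡q : p ≡ q) → subst (Vec Term ∘ arity) p≡q ts ≡ us
  atom-injective refl = refl , refl

  unify-var : ∀ {σ} x u → σ x ≡ sub σ u → ∃ (IsMGU (Unifies (var x) u))
  unify-var x (var y) _ with y ℕ.≟ x
  ... | yes refl = var , var-IsMGU refl
  ... | no y≢x   = x ↦ var y , ↦-IsMGU λ { (here x≡y) → y≢x (sym x≡y) }
  unify-var {σ} x (fn f ts) eq with x ∈? varsV ts
  ... | yes x∈ = ⊥-elim (occurs-check σ x∈ eq)
  ... | no x∉  = x ↦ fn f ts , ↦-IsMGU x∉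

  -- Recursion is on the common instance T: after the heads are solved by θ₁ the remaining
  -- problem is instantiated by θ₁ and need not be smaller, but its common instance is.
  mutual
    unify : ∀ {σ} → Finite σ → ∀ t u T → sub σ t ≡ T → sub σ u ≡ T → ∃ (IsMGU (Unifies t u))
    unify finσ (var x)   u         T          p q = unify-var x u (trans p (sym q))
    unify finσ (fn f ts) (var y)   T          p q = map₂ (IsMGU-resp sym sym) (unify-var y (fn f ts) (trans q (sym p)))
    unify finσ (fn f ts) (fn g us) (var z)    () q
    unify finσ (fn f ts) (fn g us) (fn h Ts) p q with fn-injective p | fn-injective q
    ... | refl , ts≡Ts | refl , us≡Ts = map₂ fn-IsMGU (unifyᵛ finσ ts us Ts ts≡Ts us≡Ts)

    unifyᵛ : ∀ {σ n} → Finite σ → (ts us Ts : Vec Term n) → subs σ ts ≡ Ts → subs σ us ≡ Ts →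
             ∃ (IsMGU (Unifiesᵛ ts us))
    unifyᵛ finσ [] [] [] p q = var , var-IsMGU refl
    unifyᵛ {σ} finσ (t ∷ ts) (u ∷ us) (T ∷ Ts) p q with ∷-injective p | ∷-injective q
    ... | p₁ , p₂ | q₁ , q₂ with unify finσ t u T p₁ q₁
    ... | θ₁ , mgu₁@(_ , _ , gen₁) with gen₁ σ finσ (trans p₁ (sym q₁))
    ... | δ₁ , finδ₁ , σ≗δ₁θ₁ with unifyᵛ finδ₁ (subs θ₁ ts) (subs θ₁ us) Ts
                                     (trans (sym (subs-factor σ≗δ₁θ₁ ts)) p₂) (trans (sym (subs-factor σ≗δ₁θ₁ us)) q₂)
    ... | θ₂ , mgu₂ = sub θ₂ ∘ θ₁ , ∷-IsMGU {t = t} {u} mgu₁ mgu₂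

  unifiable⇒MGU : ∀ {σ p} → Finite σ → (ts us : Vec Term (arity p)) → subs σ ts ≡ subs σ us →
                  ∃ λ θ → MGU θ (atom p ts) (atom p us)
  unifiable⇒MGU finσ ts us eq = map₂ (IsMGU-resp (cong (atom _)) atom-injectiveʳ) (unifyᵛ finσ ts us _ eq refl)
    where
      atom-injectiveʳ : ∀ {p} {ts us : Vec Term (arity p)} → atom p ts ≡ atom p us → ts ≡ us
      atom-injectiveʳ refl = refl

  var-injective : ∀ {x y} → var x ≡ var y → x ≡ y
  var-injective refl = refl

  _≟var_ : ∀ t y → Dec (t ≡ var y)
  var x   ≟var y with x ℕ.≟ y
  ... | yes refl = yes refl
  ... | no x≢y   = no (x≢y ∘ var-injective)
  fn f ts ≟var y = no λ ()

  lookup-subs-subs : ∀ {n} σ σ' (ts : Vec Term n) i → lookup (subs σ (subs σ' ts)) i ≡ sub σ (sub σ' (lookup ts i))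
  lookup-subs-subs σ σ' ts i = trans (lookup-subs σ (subs σ' ts) i) (cong (sub σ) (lookup-subs σ' ts i))

  blockSwap-renaming : ℕ → Renaming
  blockSwap-renaming N = record
    { π       = blockSwap N
    ; π⁻¹     = blockSwap N
    ; inv₁    = blockSwap-involutive N
    ; inv₂    = blockSwap-involutive N
    ; support = upTo (N + N)
    ; fixed   = λ x x∉ → blockSwap-≥ N (x∉ ∘ ∈-upTo⁺)
    }

  module _ (τ : Positions) where

    argCond⁺ : ∀ q j {η s t} → (τ q j ≡ false → t ≡ sub η s) → ArgCond η (filterOf τ q j) s t
    argCond⁺ q j h with τ q j
    ... | true  = refl
    ... | false = h refl

    argCond⁻ : ∀ q j {η s t} → τ q j ≡ false → ArgCond η (filterOf τ q j) s t → t ≡ sub η s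
    argCond⁻ q j τqj≡false cond rewrite τqj≡false = cond

    subA-moreGen : ∀ {η θ θ' δ A' A} → (∀ {z} → z ∈ varsA A' → sub δ (θ' z) ≡ sub θ (η z)) →
                   MoreGenAtom (filterOf τ) η A' A → MoreGenAtom (filterOf τ) δ (subA θ' A') (subA θ A)
    subA-moreGen {η} {θ} {θ'} {δ} agree (mg {q} {ss'} {ts} ss'≥ts) = mg λ j → argCond⁺ q j λ τqj≡false →
      let s = lookup ss' j in begin
        lookup (subs θ ts) j             ≡⟨ lookup-subs θ ts j ⟩
        sub θ (lookup ts j)              ≡⟨ cong (sub θ) (argCond⁻ q j τqj≡false (ss'≥ts j)) ⟩
        sub θ (sub η s)                  ≡⟨ sub-∘ θ η s ⟩
        sub (sub θ ∘ η) s                ≡⟨ sub-cong s (λ z∈ → sym (agree (vars-lookup ss' j z∈))) ⟩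
        sub (sub δ ∘ θ') s               ≡⟨ sym (sub-∘ δ θ' s) ⟩
        sub δ (sub θ' s)                 ≡⟨ cong (sub δ) (sym (lookup-subs θ' ss' j)) ⟩
        sub δ (lookup (subs θ' ss') j)   ∎
      where open ≡-Reasoning

  module Lifting (τ : Positions) {p : Π} {ss : Vec Term (arity p)} {Bs : List Atom}
    (dn : DNPosClause τ (atom p ss ⇐ Bs)) (ρ : Renaming) {θ : Subst} (finθ : Finite θ)
    {bs : Vec Term (arity p)} (θ-unifies : subs θ bs ≡ subs θ (subs (var ∘ Renaming.π ρ) ss))
    {η : Subst} {bs' : Vec Term (arity p)}
    (bs'≥bs : ∀ i → ArgCond η (filterOf τ p i) (lookup bs' i) (lookup bs i))
    (V : List ℕ) (bs'⊆V : varsV bs' ⊆ V) where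

    open ≡-Reasoning

    ρ₀ : ℕ → ℕ
    ρ₀ = Renaming.π ρ

    c : Clause
    c = atom p ss ⇐ Bs

    N : ℕ
    N = suc (max 0 (varsC c ++ V))

    π : ℕ → ℕ
    π = blockSwap N

    π-fresh : ∀ {y} → y ∈ varsC c → π y ∉ V
    π-fresh {y} y∈c πy∈V =
      <⇒≱ (below-N (∈-++⁺ʳ _ πy∈V)) (subst (N ≤_) (sym (blockSwap-< N (below-N (∈-++⁺ˡ y∈c)))) (m≤n+m N y))
      where
        below-N : ∀ {x} → x ∈ varsC c ++ V → x < N
        below-N = s≤s ∘ All.lookup (xs≤max 0 (varsC c ++ V))

    FilteredHeadVar : ℕ → Set
    FilteredHeadVar y = ∃ λ i → τ p i ≡ true × lookup ss i ≡ var y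

    filteredHeadVar? : ∀ y → Dec (FilteredHeadVar y)
    filteredHeadVar? y = Fin.any? λ i → (τ p i ≟ᵇ true) ×-dec (lookup ss i ≟var y)

    filteredHeadVar-∈ : ∀ {y} → FilteredHeadVar y → y ∈ varsC c
    filteredHeadVar-∈ (i , _ , ssi≡y) = ∈-++⁺ˡ (vars-lookup ss i (subst (λ t → _ ∈ vars t) (sym ssi≡y) (here refl)))

    filteredHeadVar-unique : ∀ {y} (h h' : FilteredHeadVar y) → proj₁ h ≡ proj₁ h'
    filteredHeadVar-unique (i , τi , ssi≡y) (j , _ , ssj≡y) with j Fin.≟ i | dn i τi
    ... | yes j≡i | _                = sym j≡i
    ... | no j≢i  | x , ssi≡x , linear , _ =
      ⊥-elim (linear j j≢i (subst (λ t → x ∈ vars t) (sym ssj≡y) (here (var-injective (trans (sym ssi≡x) ssi≡y)))))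

    head-var-unfiltered : ∀ {i y} → τ p i ≡ false → y ∈ vars (lookup ss i) → ¬ FilteredHeadVar y
    head-var-unfiltered {i} τi≡false y∈ (j , τj , ssj≡y) with dn j τj
    ... | x , ssj≡x , linear , _ =
      linear i (λ { refl → true≢false (trans (sym τj) τi≡false) })
        (subst (λ w → w ∈ vars (lookup ss i)) (var-injective (trans (sym ssj≡y) ssj≡x)) y∈)

    body-var-unfiltered : ∀ {q ts j y} → atom q ts ∈ Bs → τ q j ≡ false → y ∈ vars (lookup ts j) → ¬ FilteredHeadVar y
    body-var-unfiltered {q} {ts} {j} A∈ τqj≡false y∈ (i , τi , ssi≡y) with dn i τi
    ... | x , ssi≡x , _ , body =
      true≢false (trans (sym (body q ts A∈ j x∈tj)) τqj≡false)
      where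
        x∈tj : x ∈ vars (lookup ts j)
        x∈tj = subst (λ w → w ∈ vars (lookup ts j)) (var-injective (trans (sym ssi≡y) ssi≡x)) y∈

    σ : Subst
    σ z with z ∈? V | filteredHeadVar? (π z)
    ... | yes _ | _           = sub θ (η z)
    ... | no _  | yes (i , _) = sub θ (sub η (lookup bs' i))
    ... | no _  | no _        = θ (ρ₀ (π z))

    σ-V : ∀ {z} → z ∈ V → σ z ≡ sub θ (η z)
    σ-V {z} z∈V with z ∈? V | filteredHeadVar? (π z)
    ... | yes _  | _ = refl
    ... | no z∉V | _ = ⊥-elim (z∉V z∈V)

    σ-filtered : ∀ {z i} → z ∉ V → τ p i ≡ true → lookup ss i ≡ var (π z) → σ z ≡ sub θ (sub η (lookup bs' i))
    σ-filtered {z} {i} z∉V τi ssi≡πz with z ∈? V | filteredHeadVar? (π z)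
    ... | yes z∈V | _  = ⊥-elim (z∉V z∈V)
    ... | no _    | yes h = cong (λ j → sub θ (sub η (lookup bs' j))) (filteredHeadVar-unique h (i , τi , ssi≡πz))
    ... | no _    | no ¬h = ⊥-elim (¬h (i , τi , ssi≡πz))

    σ-unfiltered : ∀ {z} → z ∉ V → ¬ FilteredHeadVar (π z) → σ z ≡ θ (ρ₀ (π z))
    σ-unfiltered {z} z∉V ¬h with z ∈? V | filteredHeadVar? (π z)
    ... | yes z∈V | _     = ⊥-elim (z∉V z∈V)
    ... | no _    | yes h = ⊥-elim (¬h h)
    ... | no _    | no _  = refl

    σ-finite : Finite σ
    σ-finite = support , fixed
      where
        support : List ℕ
        support = V ++ varsC c ++ upTo (N + N) ++ Renaming.support ρ ++ proj₁ finθ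

        fixed : ∀ z → z ∉ support → σ z ≡ var z
        fixed z z∉ = begin
          σ z           ≡⟨ σ-unfiltered (z∉ ∘ ∈-++⁺ˡ) (λ h → z∉c (subst (_∈ varsC c) πz≡z (filteredHeadVar-∈ h))) ⟩
          θ (ρ₀ (π z))  ≡⟨ cong (θ ∘ ρ₀) πz≡z ⟩
          θ (ρ₀ z)      ≡⟨ cong θ (Renaming.fixed ρ z (z∉rest ∘ ∈-++⁺ˡ)) ⟩
          θ z           ≡⟨ proj₂ finθ z (z∉rest ∘ ∈-++⁺ʳ (Renaming.support ρ)) ⟩
          var z         ∎
          where
            z∉c : z ∉ varsC c
            z∉c = z∉ ∘ ∈-++⁺ʳ V ∘ ∈-++⁺ˡ
            πz≡z : π z ≡ z
            πz≡z = blockSwap-≥ N (z∉ ∘ ∈-++⁺ʳ V ∘ ∈-++⁺ʳ (varsC c) ∘ ∈-++⁺ˡ ∘ ∈-upTo⁺)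
            z∉rest : z ∉ Renaming.support ρ ++ proj₁ finθ
            z∉rest = z∉ ∘ ∈-++⁺ʳ V ∘ ∈-++⁺ʳ (varsC c) ∘ ∈-++⁺ʳ (upTo (N + N))

    σ-on-V : ∀ t → vars t ⊆ V → sub σ t ≡ sub θ (sub η t)
    σ-on-V t t⊆V = trans (sub-cong t (σ-V ∘ t⊆V)) (sym (sub-∘ θ η t))

    σ-on-renamed : ∀ t → vars t ⊆ varsC c → (∀ {y} → y ∈ vars t → ¬ FilteredHeadVar y) →
                   sub σ (sub (var ∘ π) t) ≡ sub θ (sub (var ∘ ρ₀) t)
    σ-on-renamed t t⊆c unfiltered = begin
      sub σ (sub (var ∘ π) t)  ≡⟨ sub-∘ σ (var ∘ π) t ⟩
      sub (σ ∘ π) t            ≡⟨ sub-cong t (λ y∈ → σ-π (t⊆c y∈) (unfiltered y∈)) ⟩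
      sub (θ ∘ ρ₀) t           ≡⟨ sym (sub-∘ θ (var ∘ ρ₀) t) ⟩
      sub θ (sub (var ∘ ρ₀) t) ∎
      where
        σ-π : ∀ {y} → y ∈ varsC c → ¬ FilteredHeadVar y → σ (π y) ≡ θ (ρ₀ y)
        σ-π {y} y∈c ¬h = trans (σ-unfiltered (π-fresh y∈c) (¬h ∘ subst FilteredHeadVar (blockSwap-involutive N y)))
                               (cong (θ ∘ ρ₀) (blockSwap-involutive N y))

    σ-unifies-at : ∀ i → sub σ (lookup bs' i) ≡ sub σ (sub (var ∘ π) (lookup ss i))
    σ-unifies-at i with τ p i in τi
    ... | true with dn i τi
    ...   | x , ssi≡x , _ = begin
      sub σ (lookup bs' i)                 ≡⟨ σ-on-V (lookup bs' i) (bs'⊆V ∘ vars-lookup bs' i) ⟩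
      sub θ (sub η (lookup bs' i))         ≡⟨ σ-filtered (π-fresh x∈c) τi (trans ssi≡x (cong var (sym (blockSwap-involutive N x)))) ⟨
      σ (π x)                              ≡⟨ cong (sub σ ∘ sub (var ∘ π)) ssi≡x ⟨
      sub σ (sub (var ∘ π) (lookup ss i))  ∎
      where
        x∈c : x ∈ varsC c
        x∈c = filteredHeadVar-∈ (i , τi , ssi≡x)
    σ-unifies-at i | false = begin
      sub σ (lookup bs' i)                     ≡⟨ σ-on-V (lookup bs' i) (bs'⊆V ∘ vars-lookup bs' i) ⟩
      sub θ (sub η (lookup bs' i))             ≡⟨ cong (sub θ) (argCond⁻ τ p i τi (bs'≥bs i)) ⟨
      sub θ (lookup bs i)                      ≡⟨ lookup-subs θ bs i ⟨
      lookup (subs θ bs) i                     ≡⟨ cong (λ v → lookup v i) θ-unifies ⟩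
      lookup (subs θ (subs (var ∘ ρ₀) ss)) i   ≡⟨ lookup-subs-subs θ (var ∘ ρ₀) ss i ⟩
      sub θ (sub (var ∘ ρ₀) (lookup ss i))     ≡⟨ σ-on-renamed (lookup ss i) (∈-++⁺ˡ ∘ vars-lookup ss i) (head-var-unfiltered τi) ⟨
      sub σ (sub (var ∘ π) (lookup ss i))      ∎

    σ-unifies : subs σ bs' ≡ subs σ (subs (var ∘ π) ss)
    σ-unifies = lookup-ext _ _ λ i →
      trans (lookup-subs σ bs' i) (trans (σ-unifies-at i) (sym (lookup-subs-subs σ (var ∘ π) ss i)))

    H' : Atom
    H' = atom p (subs (var ∘ π) ss)

    Bs' : List Atom
    Bs' = subQ (var ∘ π) Bs

    -- Opaque: otherwise conversion checking unfolds θ' and runs the unification algorithm.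
    opaque
      mgu : ∃ λ θ' → MGU θ' (atom p bs') H'
      mgu = unifiable⇒MGU σ-finite bs' _ σ-unifies

    θ' : Subst
    θ' = proj₁ mgu

    σ-factors : ∃ λ δ → Finite δ × σ ≗ sub δ ∘ θ'
    σ-factors = proj₂ (proj₂ (proj₂ mgu)) σ σ-finite (cong (atom p) σ-unifies)

    δ : Subst
    δ = proj₁ σ-factors

    δ-finite : Finite δ
    δ-finite = proj₁ (proj₂ σ-factors)

    σ≗δθ' : σ ≗ sub δ ∘ θ'
    σ≗δθ' = proj₂ (proj₂ σ-factors)

    renamed-apart : ∀ {x} → x ∈ varsC (H' ⇐ Bs') → x ∉ V
    renamed-apart x∈ with varsC-sub⁻ (var ∘ π) c x∈
    ... | y , y∈c , here refl = π-fresh y∈c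

    lift-query : ∀ {Xs' Xs} → (∀ {A'} → A' ∈ Xs' → varsA A' ⊆ V) →
                 MoreGenQueryFor (filterOf τ) η Xs' Xs → MoreGenQueryFor (filterOf τ) δ (subQ θ' Xs') (subQ θ Xs)
    lift-query Xs'⊆V []            = []
    lift-query Xs'⊆V (A'≥A ∷ rest) =
      subA-moreGen τ (λ z∈ → trans (sym (σ≗δθ' _)) (σ-V (Xs'⊆V (here refl) z∈))) A'≥A ∷ lift-query (Xs'⊆V ∘ there) rest

    lift-body : ∀ {Xs} → (∀ {A} → A ∈ Xs → A ∈ Bs) →
                MoreGenQueryFor (filterOf τ) δ (subQ θ' (subQ (var ∘ π) Xs)) (subQ θ (subQ (var ∘ ρ₀) Xs))
    lift-body {[]}             _      = []
    lift-body {atom q ts ∷ Xs} Xs⊆Bs = mg (λ j → argCond⁺ τ q j (lifted-arg j)) ∷ lift-body (Xs⊆Bs ∘ there)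
      where
        lifted-arg : ∀ j → τ q j ≡ false →
                     lookup (subs θ (subs (var ∘ ρ₀) ts)) j ≡ sub δ (lookup (subs θ' (subs (var ∘ π) ts)) j)
        lifted-arg j τqj≡false = begin
          lookup (subs θ (subs (var ∘ ρ₀) ts)) j          ≡⟨ lookup-subs-subs θ (var ∘ ρ₀) ts j ⟩
          sub θ (sub (var ∘ ρ₀) (lookup ts j))            ≡⟨ σ-on-renamed (lookup ts j) t⊆c (body-var-unfiltered A∈ τqj≡false) ⟨
          sub σ (sub (var ∘ π) (lookup ts j))             ≡⟨ sub-factor σ≗δθ' (sub (var ∘ π) (lookup ts j)) ⟩
          sub δ (sub θ' (sub (var ∘ π) (lookup ts j)))    ≡⟨ cong (sub δ) (lookup-subs-subs θ' (var ∘ π) ts j) ⟨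
          sub δ (lookup (subs θ' (subs (var ∘ π) ts)) j)  ∎
          where
            A∈ : atom q ts ∈ Bs
            A∈ = Xs⊆Bs (here refl)
            t⊆c : vars (lookup ts j) ⊆ varsC c
            t⊆c = ∈-++⁺ʳ (varsV ss) ∘ ∈-varsQ A∈ ∘ vars-lookup ts j

  clause-DN : ∀ τ c → DNPosClause τ c → DNClause (filterOf τ) c
  clause-DN τ (atom p ss ⇐ Bs) dn _ _ _
    (As , _ , Cs , _ , _ , θ , refl , refl , (ρ , refl) , _ , (finθ , θ-unifies , _) , refl)
    _ (η , finη , Q'≥Q) with Pointwise-++-∷⁻ As Q'≥Q
  ... | As' , _ , Cs' , refl , As'≥As , mg {ss = bs'} B'≥B , Cs'≥Cs with atom-injective θ-unifies
  ... | refl , bs-unifies =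
    subQ θ' (As' ++ Bs' ++ Cs') ,
    (As' , atom p bs' , Cs' , H' , Bs' , θ' , refl , Pointwise-length As'≥As ,
      (blockSwap-renaming N , refl) , (λ _ → renamed-apart) , proj₂ mgu , refl) ,
    (η , finη , Q'≥Q) ,
    (δ , δ-finite , lifted)
    where
      Q' : Query
      Q' = As' ++ atom p bs' ∷ Cs'

      open Lifting τ dn ρ finθ bs-unifies {bs' = bs'} B'≥B (varsQ Q') (∈-varsQ {Xs = Q'} (∈-++⁺ʳ As' (here refl)))

      lifted : MoreGenQueryFor (filterOf τ) δ (subQ θ' (As' ++ Bs' ++ Cs')) (subQ θ (As ++ subQ (var ∘ ρ₀) Bs ++ Cs))
      lifted = Pointwise-subQ-++⁺ As' As (lift-query (∈-varsQ {Xs = Q'} ∘ ∈-++⁺ˡ) As'≥As)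
                 (Pointwise-subQ-++⁺ Bs' (subQ (var ∘ ρ₀) Bs) (lift-body id)
                   (lift-query (∈-varsQ {Xs = Q'} ∘ ∈-++⁺ʳ As' ∘ there) Cs'≥Cs))

theorem4 : (L : Signature) (τ : Lang.Positions L) (P : Lang.Program L) →
    Lang.DNPosProgram L τ P → Lang.DNProgram L (Lang.filterOf L τ) P
theorem4 L τ P dn c c∈P = clause-DN L τ c (dn c c∈P)
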